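{- Let $T(z)$ be the formal power series with $T(z)=1+zT(z)^3$, $T(0)=1$, and let $X=X(z)$ be the unique formal power series with $X(0)=0$ satisfying $X=zT^2X\left(\frac1X+1+X\right)$. Then $X$ also satisfies $X=z\frac{(1+X+X^2)^3}{(1+X^2)^2}$ and $T=\frac{1+X+X^2}{1+X^2}$; $X$ has non-negative coefficients and $$X=\frac{1-zT^2-\sqrt{1-2zT^2-3z^2T^4}}{2zT^2}=\frac{1-\sqrt{1-4\tilde T^2}}{2\tilde T},\qquad \tilde T=T-1.$$ Moreover, for $j\ge -1$, the generating function $T_j(z)$ of naturally embedded ternary trees with no label greater than $j$ is $$T_j(z)=T(z)\,\frac{(1-X^{j+2}(z))(1-X^{j+5}(z))}{(1-X^{j+3}(z))(1-X^{j+4}(z))}.$$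
   Context: A ternary tree is either an external node (leaf) or an internal node with three ordered subtrees (left, center, right); size = number of internal nodes, and $T(z)=\sum_n T_nz^n$ counts ternary trees by size. In the natural embedding the root has label $0$ and the left, center, right children of a node with label $j\in\mathbb{Z}$ have labels $j-1,j,j+1$. $T_j(z)$ is the generating function, by size, of ternary trees in which no internal node has label greater than $j$ (so $T_{ -1}(z)=1$). -}

module Defs where

open import Data.Nat using (ℕ; zero; suc; _∸_)
open import Data.Integer as ℤ using (ℤ; +_; _≤_; 0ℤ; 1ℤ)
open import Data.Fin using (Fin)
open import Data.Product using (Σ; _×_)
open import Data.Unit using (⊤)
open import Function.Bundles using (_↔_)
open import Relation.Binary.PropositionalEquality using (_≡_)

-- Formal power series with integer coefficients: PS = ℕ → ℤ,
-- the n-th coefficient being the value at n.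

PS : Set
PS = ℕ → ℤ

infix 4 _≈_
_≈_ : PS → PS → Set
f ≈ g = ∀ n → f n ≡ g n

cst : ℤ → PS
cst c zero    = c
cst c (suc n) = 0ℤ

𝟙 : PS
𝟙 = cst 1ℤ

zS : PS
zS (suc zero) = 1ℤ
zS _          = 0ℤ

infixl 6 _⊕_ _⊖_
infixl 7 _⊗_ _·_
infixr 8 _^_

_⊕_ : PS → PS → PS
(f ⊕ g) n = f n ℤ.+ g n

_⊖_ : PS → PS → PS
(f ⊖ g) n = f n ℤ.- g n

_·_ : ℤ → PS → PS
(c · f) n = c ℤ.* f n

sumTo : ℕ → (ℕ → ℤ) → ℤ
sumTo zero    h = h zero
sumTo (suc n) h = sumTo n h ℤ.+ h (suc n)

_⊗_ : PS → PS → PS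
(f ⊗ g) n = sumTo n (λ i → f i ℤ.* g (n ∸ i))

_^_ : PS → ℕ → PS
f ^ zero  = 𝟙
f ^ suc k = f ⊗ (f ^ k)

data Tern : Set where
  leaf : Tern
  node : Tern → Tern → Tern → Tern

size : Tern → ℕ
size leaf         = zero
size (node a b c) = suc (size a Data.Nat.+ size b Data.Nat.+ size c)

-- Bounded j ℓ t : in the natural embedding of t with root label ℓ
-- (children of a node labelled i get labels i-1, i, i+1),
-- no internal node has label greater than j.
Bounded : ℤ → ℤ → Tern → Set
Bounded j ℓ leaf         = ⊤
Bounded j ℓ (node a b c) =
  (ℓ ≤ j) × Bounded j (ℓ ℤ.- 1ℤ) a × Bounded j ℓ b × Bounded j (ℓ ℤ.+ 1ℤ) c

BoundedTrees : ℤ → ℕ → Set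
BoundedTrees j n = Σ Tern (λ t → (size t ≡ n) × Bounded j 0ℤ t)

IsTjGF : ℤ → PS → Set
IsTjGF j F = ∀ n → Σ ℕ (λ c → (F n ≡ + c) × (Fin c ↔ BoundedTrees j n))

-- With a = z T², the equation for X reads a X² + (a - 1) X + a = 0, and eliminating z against
-- T = 1 + z T³ gives T (1 + X²) = 1 + X + X². Every algebraic claim is then a polynomial
-- identity in T, X, z up to a factor whose constant term is non-zero, and such factors can be
-- cancelled in ℤ[[z]] coefficient by coefficient.
--
-- Cutting a tree at its root shows T_{-1} = 1 and T_j = 1 + z T_{j-1} T_j T_{j+1} for j ≥ 0.
-- Because of the factor z this recursion has a unique solution, and
-- T (1 - X^{j+2}) (1 - X^{j+5}) / ((1 - X^{j+3}) (1 - X^{j+4})) solves it: after clearing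
-- denominators and T it reduces to
--   (1 + X + X²) (1 - X^{j+3}) (1 - X^{j+6}) = (1 + X²) (1 - X^{j+4}) (1 - X^{j+5}) + X (1 - X^{j+2}) (1 - X^{j+7}).

module Submission where

open import Defs
open import Data.Nat using (ℕ)
open import Data.Integer as ℤ using (ℤ; +_; -[1+_]; _≤_; 0ℤ; 1ℤ; ∣_∣)
open import Data.Product using (Σ; _×_)
open import Relation.Binary.PropositionalEquality using (_≡_)

open import Data.Nat as N using (zero; suc; _∸_; _<_; z≤n; s≤s)
import Data.Nat.Properties as NP
import Data.Integer.Properties as ZP
open import Data.Nat.Induction using (<-rec)
open import Data.Product using (_,_)
open import Data.Sum using (_⊎_; inj₁; inj₂)
open import Data.Maybe using (Maybe; just; nothing)
open import Data.Empty using (⊥; ⊥-elim)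
open import Data.Unit using (⊤; tt)
open import Data.Fin using (Fin)
import Data.Fin.Properties as FinP
import Data.Fin.Permutation as Perm
open import Function using (_∘_)
open import Function.Bundles using (_↔_; mk↔ₛ′)
open import Function.Properties.Inverse using (↔-trans; ↔-sym)
open import Data.Sum.Function.Propositional using (_⊎-↔_)
open import Data.Product.Function.NonDependent.Propositional using (_×-↔_)
open import Relation.Nullary using (¬_; yes; no)
open import Relation.Binary.PropositionalEquality
  using (_≢_; refl; sym; trans; cong; cong₂; subst; module ≡-Reasoning)
open import Algebra.Structures _≈_ using (IsCommutativeSemiring)
open import Algebra.Solver.Ring.AlmostCommutativeRing
  using (AlmostCommutativeRing; _-Raw-AlmostCommutative⟶_; Induced-equivalence)
open import Data.Integer.Solver using (module +-*-Solver)
open +-*-Solver using ()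
  renaming (solve to ℤ-solve; con to ℤ-con; _:+_ to _ℤ:+_; _:-_ to _ℤ:-_; _:=_ to _ℤ:=_)
open import Algebra.Properties.CommutativeSemigroup ZP.+-commutativeSemigroup
  using () renaming (interchange to +-interchange)

sumTo-cong : ∀ n {h k : ℕ → ℤ} → (∀ i → i N.≤ n → h i ≡ k i) → sumTo n h ≡ sumTo n k
sumTo-cong zero    e = e 0 z≤n
sumTo-cong (suc n) e =
  cong₂ ℤ._+_ (sumTo-cong n (λ i i≤n → e i (NP.m≤n⇒m≤1+n i≤n))) (e (suc n) NP.≤-refl)

sumTo-zero : ∀ n {h : ℕ → ℤ} → (∀ i → i N.≤ n → h i ≡ 0ℤ) → sumTo n h ≡ 0ℤ
sumTo-zero zero    e = e 0 z≤n
sumTo-zero (suc n) e =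
  cong₂ ℤ._+_ (sumTo-zero n (λ i i≤n → e i (NP.m≤n⇒m≤1+n i≤n))) (e (suc n) NP.≤-refl)

sumTo-+ : ∀ n (h k : ℕ → ℤ) → sumTo n (λ i → h i ℤ.+ k i) ≡ sumTo n h ℤ.+ sumTo n k
sumTo-+ zero    h k = refl
sumTo-+ (suc n) h k = trans (cong (ℤ._+ (h (suc n) ℤ.+ k (suc n))) (sumTo-+ n h k))
  (+-interchange (sumTo n h) (sumTo n k) (h (suc n)) (k (suc n)))

sumTo-*ˡ : ∀ n c (h : ℕ → ℤ) → c ℤ.* sumTo n h ≡ sumTo n (λ i → c ℤ.* h i)
sumTo-*ˡ zero    c h = refl
sumTo-*ˡ (suc n) c h = trans (ZP.*-distribˡ-+ c (sumTo n h) (h (suc n)))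
  (cong (ℤ._+ (c ℤ.* h (suc n))) (sumTo-*ˡ n c h))

sumTo-*ʳ : ∀ n c (h : ℕ → ℤ) → sumTo n h ℤ.* c ≡ sumTo n (λ i → h i ℤ.* c)
sumTo-*ʳ zero    c h = refl
sumTo-*ʳ (suc n) c h = trans (ZP.*-distribʳ-+ c (sumTo n h) (h (suc n)))
  (cong (ℤ._+ (h (suc n) ℤ.* c)) (sumTo-*ʳ n c h))

sumTo-neg : ∀ n (h : ℕ → ℤ) → ℤ.- sumTo n h ≡ sumTo n (λ i → ℤ.- h i)
sumTo-neg zero    h = refl
sumTo-neg (suc n) h = trans (ZP.neg-distrib-+ (sumTo n h) (h (suc n)))
  (cong (ℤ._+ (ℤ.- h (suc n))) (sumTo-neg n h))

sumTo-suc : ∀ n (h : ℕ → ℤ) → sumTo (suc n) h ≡ h 0 ℤ.+ sumTo n (h ∘ suc)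
sumTo-suc zero    h = refl
sumTo-suc (suc n) h = trans (cong (ℤ._+ h (suc (suc n))) (sumTo-suc n h))
  (ZP.+-assoc (h 0) (sumTo n (h ∘ suc)) (h (suc (suc n))))

sumTo-reverse : ∀ n (h : ℕ → ℤ) → sumTo n h ≡ sumTo n (λ i → h (n ∸ i))
sumTo-reverse zero    h = refl
sumTo-reverse (suc n) h = begin
  sumTo (suc n) h                          ≡⟨ sumTo-suc n h ⟩
  h 0 ℤ.+ sumTo n (h ∘ suc)                ≡⟨ ZP.+-comm (h 0) _ ⟩
  sumTo n (h ∘ suc) ℤ.+ h 0                ≡⟨ cong (ℤ._+ h 0) (sumTo-reverse n (h ∘ suc)) ⟩
  sumTo n (λ i → h (suc (n ∸ i))) ℤ.+ h 0
    ≡⟨ cong₂ ℤ._+_ (sumTo-cong n (λ i i≤n → cong h (sym (NP.+-∸-assoc 1 i≤n))))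
                   (cong h (sym (NP.n∸n≡0 n))) ⟩
  sumTo (suc n) (λ i → h (suc n ∸ i))      ∎
  where open ≡-Reasoning

sumTo-triangle : ∀ n (F : ℕ → ℕ → ℤ) →
  sumTo n (λ i → sumTo i (λ a → F a i)) ≡ sumTo n (λ a → sumTo (n ∸ a) (λ b → F a (a N.+ b)))
sumTo-triangle zero    F = refl
sumTo-triangle (suc n) F = begin
  sumTo n (λ i → sumTo i (λ a → F a i)) ℤ.+ (sumTo n (λ a → F a (suc n)) ℤ.+ F (suc n) (suc n))
    ≡⟨ cong (ℤ._+ (sumTo n (λ a → F a (suc n)) ℤ.+ F (suc n) (suc n))) (sumTo-triangle n F) ⟩
  sumTo n rows ℤ.+ (sumTo n (λ a → F a (suc n)) ℤ.+ F (suc n) (suc n))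
    ≡⟨ sym (ZP.+-assoc (sumTo n rows) _ _) ⟩
  (sumTo n rows ℤ.+ sumTo n (λ a → F a (suc n))) ℤ.+ F (suc n) (suc n)
    ≡⟨ cong (ℤ._+ F (suc n) (suc n)) (sym (sumTo-+ n rows (λ a → F a (suc n)))) ⟩
  sumTo n (λ a → rows a ℤ.+ F a (suc n)) ℤ.+ F (suc n) (suc n)
    ≡⟨ cong₂ ℤ._+_ (sumTo-cong n extend-row) (cong (F (suc n)) (sym (NP.+-identityʳ (suc n)))) ⟩
  sumTo n rows′ ℤ.+ F (suc n) (suc n N.+ 0)
    ≡⟨ cong (λ k → sumTo n rows′ ℤ.+ sumTo k (λ b → F (suc n) (suc n N.+ b))) (sym (NP.n∸n≡0 n)) ⟩
  sumTo (suc n) rows′ ∎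
  where
  open ≡-Reasoning
  rows rows′ : ℕ → ℤ
  rows  a = sumTo (n ∸ a) (λ b → F a (a N.+ b))
  rows′ a = sumTo (suc n ∸ a) (λ b → F a (a N.+ b))
  extend-row : ∀ a → a N.≤ n → rows a ℤ.+ F a (suc n) ≡ rows′ a
  extend-row a a≤n rewrite NP.+-∸-assoc 1 a≤n =
    cong (λ k → rows a ℤ.+ F a k) (sym (trans (NP.+-suc a (n ∸ a)) (cong suc (NP.m+[n∸m]≡n a≤n))))

-- The ring of formal power series

𝟘 : PS
𝟘 = cst 0ℤ

neg : PS → PS
neg f n = ℤ.- f n

𝟘-coeff : ∀ n → 𝟘 n ≡ 0ℤ
𝟘-coeff zero    = refl
𝟘-coeff (suc n) = refl

≈-refl : ∀ {f} → f ≈ f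
≈-refl n = refl

≈-sym : ∀ {f g} → f ≈ g → g ≈ f
≈-sym e n = sym (e n)

≈-trans : ∀ {f g h} → f ≈ g → g ≈ h → f ≈ h
≈-trans e e′ n = trans (e n) (e′ n)

⊕-cong : ∀ {f f′ g g′} → f ≈ f′ → g ≈ g′ → f ⊕ g ≈ f′ ⊕ g′
⊕-cong e e′ n = cong₂ ℤ._+_ (e n) (e′ n)

⊗-cong : ∀ {f f′ g g′} → f ≈ f′ → g ≈ g′ → f ⊗ g ≈ f′ ⊗ g′
⊗-cong e e′ n = sumTo-cong n (λ i _ → cong₂ ℤ._*_ (e i) (e′ (n ∸ i)))

neg-cong : ∀ {f g} → f ≈ g → neg f ≈ neg g
neg-cong e n = cong ℤ.-_ (e n)

⊕-assoc : ∀ f g h → (f ⊕ g) ⊕ h ≈ f ⊕ (g ⊕ h)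
⊕-assoc f g h n = ZP.+-assoc (f n) (g n) (h n)

⊕-comm : ∀ f g → f ⊕ g ≈ g ⊕ f
⊕-comm f g n = ZP.+-comm (f n) (g n)

⊕-identityˡ : ∀ f → 𝟘 ⊕ f ≈ f
⊕-identityˡ f n = trans (cong (ℤ._+ f n) (𝟘-coeff n)) (ZP.+-identityˡ (f n))

⊕-identityʳ : ∀ f → f ⊕ 𝟘 ≈ f
⊕-identityʳ f = ≈-trans (⊕-comm f 𝟘) (⊕-identityˡ f)

⊗-comm : ∀ f g → f ⊗ g ≈ g ⊗ f
⊗-comm f g n = trans (sumTo-reverse n _) (sumTo-cong n (λ i i≤n →
  trans (ZP.*-comm (f (n ∸ i)) _) (cong (λ k → g k ℤ.* f (n ∸ i)) (NP.m∸[m∸n]≡n i≤n))))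

⊗-assoc : ∀ f g h → (f ⊗ g) ⊗ h ≈ f ⊗ (g ⊗ h)
⊗-assoc f g h n = begin
  sumTo n (λ i → sumTo i (λ a → f a ℤ.* g (i ∸ a)) ℤ.* h (n ∸ i))
    ≡⟨ sumTo-cong n (λ i _ → sumTo-*ʳ i (h (n ∸ i)) _) ⟩
  sumTo n (λ i → sumTo i (λ a → f a ℤ.* g (i ∸ a) ℤ.* h (n ∸ i)))
    ≡⟨ sumTo-triangle n (λ a i → f a ℤ.* g (i ∸ a) ℤ.* h (n ∸ i)) ⟩
  sumTo n (λ a → sumTo (n ∸ a) (λ b → f a ℤ.* g ((a N.+ b) ∸ a) ℤ.* h (n ∸ (a N.+ b))))
    ≡⟨ sumTo-cong n (λ a _ → sumTo-cong (n ∸ a) (λ b _ → trans (ZP.*-assoc (f a) _ _)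
         (cong₂ (λ k l → f a ℤ.* (g k ℤ.* h l)) (NP.m+n∸m≡n a b) (sym (NP.∸-+-assoc n a b))))) ⟩
  sumTo n (λ a → sumTo (n ∸ a) (λ b → f a ℤ.* (g b ℤ.* h ((n ∸ a) ∸ b))))
    ≡⟨ sumTo-cong n (λ a _ → sym (sumTo-*ˡ (n ∸ a) (f a) _)) ⟩
  sumTo n (λ a → f a ℤ.* sumTo (n ∸ a) (λ b → g b ℤ.* h ((n ∸ a) ∸ b))) ∎
  where open ≡-Reasoning

⊗-distribˡ : ∀ f g h → f ⊗ (g ⊕ h) ≈ f ⊗ g ⊕ f ⊗ h
⊗-distribˡ f g h n =
  trans (sumTo-cong n (λ i _ → ZP.*-distribˡ-+ (f i) _ _)) (sumTo-+ n _ _)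

⊗-distribʳ : ∀ f g h → (g ⊕ h) ⊗ f ≈ g ⊗ f ⊕ h ⊗ f
⊗-distribʳ f g h n =
  trans (sumTo-cong n (λ i _ → ZP.*-distribʳ-+ (f (n ∸ i)) (g i) _)) (sumTo-+ n _ _)

cst-⊗ : ∀ c f n → (cst c ⊗ f) n ≡ c ℤ.* f n
cst-⊗ c f zero    = refl
cst-⊗ c f (suc n) = trans (sumTo-suc n _)
  (trans (cong (λ x → c ℤ.* f (suc n) ℤ.+ x) (sumTo-zero n (λ _ _ → refl))) (ZP.+-identityʳ _))

⊗-identityˡ : ∀ f → 𝟙 ⊗ f ≈ f
⊗-identityˡ f n = trans (cst-⊗ 1ℤ f n) (ZP.*-identityˡ (f n))

⊗-identityʳ : ∀ f → f ⊗ 𝟙 ≈ f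
⊗-identityʳ f = ≈-trans (⊗-comm f 𝟙) (⊗-identityˡ f)

⊗-zeroˡ : ∀ f → 𝟘 ⊗ f ≈ 𝟘
⊗-zeroˡ f n = trans (cst-⊗ 0ℤ f n) (sym (𝟘-coeff n))

⊗-zeroʳ : ∀ f → f ⊗ 𝟘 ≈ 𝟘
⊗-zeroʳ f = ≈-trans (⊗-comm f 𝟘) (⊗-zeroˡ f)

neg-⊗ : ∀ f g → neg f ⊗ g ≈ neg (f ⊗ g)
neg-⊗ f g n = trans (sumTo-cong n (λ i _ → sym (ZP.neg-distribˡ-* (f i) (g (n ∸ i)))))
  (sym (sumTo-neg n _))

neg-⊕ : ∀ f g → neg f ⊕ neg g ≈ neg (f ⊕ g)
neg-⊕ f g n = sym (ZP.neg-distrib-+ (f n) (g n))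

⊕-⊗-isCommutativeSemiring : IsCommutativeSemiring _⊕_ _⊗_ 𝟘 𝟙
⊕-⊗-isCommutativeSemiring = record
  { isSemiring = record
    { isSemiringWithoutAnnihilatingZero = record
      { +-isCommutativeMonoid = record
        { isMonoid = record
          { isSemigroup = record
            { isMagma = record
              { isEquivalence = record { refl = ≈-refl ; sym = ≈-sym ; trans = ≈-trans }
              ; ∙-cong = ⊕-cong }
            ; assoc = ⊕-assoc }
          ; identity = ⊕-identityˡ , ⊕-identityʳ }
        ; comm = ⊕-comm }
      ; *-cong = ⊗-cong
      ; *-assoc = ⊗-assoc
      ; *-identity = ⊗-identityˡ , ⊗-identityʳ
      ; distrib = ⊗-distribˡ , ⊗-distribʳ }
    ; zero = ⊗-zeroˡ , ⊗-zeroʳ }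
  ; *-comm = ⊗-comm }

PS-almostCommutativeRing : AlmostCommutativeRing _ _
PS-almostCommutativeRing = record
  { Carrier = PS ; _≈_ = _≈_ ; _+_ = _⊕_ ; _*_ = _⊗_ ; -_ = neg ; 0# = 𝟘 ; 1# = 𝟙
  ; isAlmostCommutativeRing = record
    { isCommutativeSemiring = ⊕-⊗-isCommutativeSemiring
    ; -‿cong = neg-cong
    ; -‿*-distribˡ = neg-⊗
    ; -‿+-comm = neg-⊕ } }

cst-homomorphism : ℤ.+-*-rawRing -Raw-AlmostCommutative⟶ PS-almostCommutativeRing
cst-homomorphism = record
  { ⟦_⟧    = cst
  ; +-homo = λ a b → λ { zero → refl ; (suc n) → refl }
  ; *-homo = λ a b → λ { zero → refl
                       ; (suc n) → sym (trans (cst-⊗ a (cst b) (suc n)) (ZP.*-zeroʳ a)) }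
  ; -‿homo = λ a → λ { zero → refl ; (suc n) → refl }
  ; 0-homo = λ { zero → refl ; (suc n) → refl }
  ; 1-homo = λ { zero → refl ; (suc n) → refl } }

cst-≟ : ∀ a b → Maybe (Induced-equivalence cst-homomorphism a b)
cst-≟ a b with a ZP.≟ b
... | yes refl = just ≈-refl
... | no  _    = nothing

open import Algebra.Solver.Ring ℤ.+-*-rawRing PS-almostCommutativeRing cst-homomorphism cst-≟
  using (Polynomial; con; solve)
  renaming (_:+_ to _P+_; _:*_ to _P*_; _:-_ to _P-_; _:=_ to _P=_; _:^_ to _P^_)

zS⊗-suc : ∀ F n → (zS ⊗ F) (suc n) ≡ F n
zS⊗-suc F n = trans (sumTo-suc n _) (trans (ZP.+-identityˡ _) (shifted n))
  where
  shifted : ∀ n → sumTo n (λ i → zS (suc i) ℤ.* F (n ∸ i)) ≡ F n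
  shifted zero    = ZP.*-identityˡ (F 0)
  shifted (suc n) = trans (sumTo-suc n _)
    (trans (cong₂ ℤ._+_ (ZP.*-identityˡ (F (suc n))) (sumTo-zero n (λ _ _ → refl)))
           (ZP.+-identityʳ (F (suc n))))

·≈cst⊗ : ∀ c f → c · f ≈ cst c ⊗ f
·≈cst⊗ c f n = sym (cst-⊗ c f n)

AgreeUpTo : ℕ → PS → PS → Set
AgreeUpTo n f g = ∀ i → i N.≤ n → f i ≡ g i

⊗-agreeUpTo : ∀ {n f f′ g g′} → AgreeUpTo n f f′ → AgreeUpTo n g g′ → AgreeUpTo n (f ⊗ g) (f′ ⊗ g′)
⊗-agreeUpTo ef eg i i≤n = sumTo-cong i (λ a a≤i →
  cong₂ ℤ._*_ (ef a (NP.≤-trans a≤i i≤n)) (eg (i ∸ a) (NP.≤-trans (NP.m∸n≤m i a) i≤n)))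

⊗-coeff-lowest : ∀ A B n → (∀ i → i < n → A i ≡ 0ℤ) → (A ⊗ B) n ≡ A n ℤ.* B 0
⊗-coeff-lowest A B zero    _     = refl
⊗-coeff-lowest A B (suc n) below = begin
  sumTo n (λ i → A i ℤ.* B (suc n ∸ i)) ℤ.+ A (suc n) ℤ.* B (n ∸ n)
    ≡⟨ cong₂ ℤ._+_ (sumTo-zero n (λ i i≤n → cong (ℤ._* B (suc n ∸ i)) (below i (s≤s i≤n))))
                   (cong (λ k → A (suc n) ℤ.* B k) (NP.n∸n≡0 n)) ⟩
  0ℤ ℤ.+ A (suc n) ℤ.* B 0 ≡⟨ ZP.+-identityˡ _ ⟩
  A (suc n) ℤ.* B 0        ∎
  where open ≡-Reasoning

i*j≡0⇒i≡0 : ∀ i {j} → j ≢ 0ℤ → i ℤ.* j ≡ 0ℤ → i ≡ 0ℤ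
i*j≡0⇒i≡0 i j≢0 ij≡0 with ZP.i*j≡0⇒i≡0∨j≡0 i ij≡0
... | inj₁ i≡0 = i≡0
... | inj₂ j≡0 = ⊥-elim (j≢0 j≡0)

⊗-cancel-coeff : ∀ A B n → B 0 ≢ 0ℤ → (∀ i → i < n → A i ≡ 0ℤ) → (A ⊗ B) n ≡ 0ℤ → A n ≡ 0ℤ
⊗-cancel-coeff A B n B₀≢0 below AB≡0 =
  i*j≡0⇒i≡0 (A n) B₀≢0 (trans (sym (⊗-coeff-lowest A B n below)) AB≡0)

⊗-cancelʳ : ∀ A B → B 0 ≢ 0ℤ → A ⊗ B ≈ 𝟘 → A ≈ 𝟘
⊗-cancelʳ A B B₀≢0 AB≈0 n = trans (vanishes n) (sym (𝟘-coeff n))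
  where
  vanishes : ∀ n → A n ≡ 0ℤ
  vanishes = <-rec _ λ n below →
    ⊗-cancel-coeff A B n B₀≢0 (λ i → below) (trans (AB≈0 n) (𝟘-coeff n))

⊖≈𝟘⇒≈ : ∀ {L R} → L ⊖ R ≈ 𝟘 → L ≈ R
⊖≈𝟘⇒≈ {L} {R} e n = ZP.i-j≡0⇒i≡j (L n) (R n) (trans (e n) (𝟘-coeff n))

≈⇒⊖≈𝟘 : ∀ {L R} → L ≈ R → L ⊖ R ≈ 𝟘
≈⇒⊖≈𝟘 e n = trans (ZP.i≡j⇒i-j≡0 (e n)) (sym (𝟘-coeff n))

≈-cancelʳ : ∀ {L R} B → B 0 ≢ 0ℤ → (L ⊖ R) ⊗ B ≈ 𝟘 → L ≈ R
≈-cancelʳ {L} {R} B B₀≢0 e = ⊖≈𝟘⇒≈ (⊗-cancelʳ (L ⊖ R) B B₀≢0 e)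

lincomb₂-≈𝟘 : ∀ a b {e f} → e ≈ 𝟘 → f ≈ 𝟘 → a ⊗ e ⊕ b ⊗ f ≈ 𝟘
lincomb₂-≈𝟘 a b e≈0 f≈0 = ≈-trans (⊕-cong (⊗-cong (≈-refl {a}) e≈0) (⊗-cong (≈-refl {b}) f≈0))
  (solve 2 (λ a b → a P* con 0ℤ P+ b P* con 0ℤ P= con 0ℤ) ≈-refl a b)

lincomb₃-≈𝟘 : ∀ a b c {e f g} → e ≈ 𝟘 → f ≈ 𝟘 → g ≈ 𝟘 → a ⊗ e ⊕ b ⊗ f ⊕ c ⊗ g ≈ 𝟘
lincomb₃-≈𝟘 a b c e≈0 f≈0 g≈0 =
  ≈-trans (⊕-cong (lincomb₂-≈𝟘 a b e≈0 f≈0) (⊗-cong (≈-refl {c}) g≈0))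
    (solve 1 (λ c → con 0ℤ P+ c P* con 0ℤ P= con 0ℤ) ≈-refl c)

NonNegUpTo : ℕ → PS → Set
NonNegUpTo m f = ∀ i → i N.≤ m → 0ℤ ≤ f i

0≤+ : ∀ {n} → 0ℤ ≤ + n
0≤+ = ℤ.+≤+ z≤n

0≤-+ : ∀ {a b} → 0ℤ ≤ a → 0ℤ ≤ b → 0ℤ ≤ a ℤ.+ b
0≤-+ {+ m} {+ n} _ _ = 0≤+

0≤-* : ∀ {a b} → 0ℤ ≤ a → 0ℤ ≤ b → 0ℤ ≤ a ℤ.* b
0≤-* {+ m} {+ n} _ _ = subst (0ℤ ≤_) (ZP.pos-* m n) 0≤+

0≤-sumTo : ∀ n (h : ℕ → ℤ) → (∀ i → i N.≤ n → 0ℤ ≤ h i) → 0ℤ ≤ sumTo n h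
0≤-sumTo zero    h h≥0 = h≥0 0 z≤n
0≤-sumTo (suc n) h h≥0 =
  0≤-+ (0≤-sumTo n h (λ i i≤n → h≥0 i (NP.m≤n⇒m≤1+n i≤n))) (h≥0 (suc n) NP.≤-refl)

nonNeg-𝟙 : ∀ m → NonNegUpTo m 𝟙
nonNeg-𝟙 m zero    _ = 0≤+
nonNeg-𝟙 m (suc i) _ = 0≤+

nonNeg-⊕ : ∀ {m f g} → NonNegUpTo m f → NonNegUpTo m g → NonNegUpTo m (f ⊕ g)
nonNeg-⊕ f≥0 g≥0 i i≤m = 0≤-+ (f≥0 i i≤m) (g≥0 i i≤m)

nonNeg-⊗ : ∀ {m f g} → NonNegUpTo m f → NonNegUpTo m g → NonNegUpTo m (f ⊗ g)
nonNeg-⊗ f≥0 g≥0 i i≤m = 0≤-sumTo i _ (λ a a≤i →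
  0≤-* (f≥0 a (NP.≤-trans a≤i i≤m)) (g≥0 (i ∸ a) (NP.≤-trans (NP.m∸n≤m i a) i≤m)))

nonNeg-^ : ∀ {m f} k → NonNegUpTo m f → NonNegUpTo m (f ^ k)
nonNeg-^ {m} zero    f≥0 = nonNeg-𝟙 m
nonNeg-^     (suc k) f≥0 = nonNeg-⊗ f≥0 (nonNeg-^ k f≥0)

nonNeg-induction : ∀ f → 0ℤ ≤ f 0 → (∀ m → NonNegUpTo m f → 0ℤ ≤ f (suc m)) → ∀ n → 0ℤ ≤ f n
nonNeg-induction f f₀≥0 step = <-rec _ λ
  { zero    _     → f₀≥0
  ; (suc m) below → step m (λ i i≤m → below (s≤s i≤m)) }

-- Uniqueness for the depth recursion

around : (ℕ → PS) → ℕ → PS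
around W d = W (2 N.+ d) ⊗ W (1 N.+ d) ⊗ W d

-- Thanks to the factor zS, coefficient n of W (1 + d) ⊗ B d only involves coefficients < n of the W e.
recursion-unique : (U V B P : ℕ → PS) → (∀ d → B d 0 ≢ 0ℤ) → U 0 ≈ V 0
  → (∀ d → U (suc d) ⊗ B d ≈ P d ⊕ zS ⊗ around U d)
  → (∀ d → V (suc d) ⊗ B d ≈ P d ⊕ zS ⊗ around V d)
  → ∀ d → U d ≈ V d
recursion-unique U V B P B₀≢0 base U-rec V-rec d n = <-rec _ step n d
  where
  AgreeBelow : ℕ → Set
  AgreeBelow n = ∀ {m} → m < n → ∀ d → U d m ≡ V d m

  zS⊗around-agree : ∀ n → AgreeBelow n → ∀ d → (zS ⊗ around U d) n ≡ (zS ⊗ around V d) n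
  zS⊗around-agree zero    _     d = refl
  zS⊗around-agree (suc n) below d = begin
    (zS ⊗ around U d) (suc n) ≡⟨ zS⊗-suc (around U d) n ⟩
    around U d n              ≡⟨ ⊗-agreeUpTo (⊗-agreeUpTo (agree (2 N.+ d)) (agree (1 N.+ d)))
                                             (agree d) n NP.≤-refl ⟩
    around V d n              ≡⟨ sym (zS⊗-suc (around V d) n) ⟩
    (zS ⊗ around V d) (suc n) ∎
    where
    open ≡-Reasoning
    agree : ∀ e → AgreeUpTo n (U e) (V e)
    agree e i i≤n = below (s≤s i≤n) e

  step : ∀ n → AgreeBelow n → ∀ d → U d n ≡ V d n
  step n below zero    = base n
  step n below (suc d) = ZP.i-j≡0⇒i≡j _ _
    (⊗-cancel-coeff (U (suc d) ⊖ V (suc d)) (B d) n (B₀≢0 d)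
      (λ i i<n → ZP.i≡j⇒i-j≡0 (below i<n (suc d))) difference)
    where
    open ≡-Reasoning
    difference : ((U (suc d) ⊖ V (suc d)) ⊗ B d) n ≡ 0ℤ
    difference = begin
      ((U (suc d) ⊖ V (suc d)) ⊗ B d) n
        ≡⟨ solve 3 (λ u v b → (u P- v) P* b P= u P* b P- v P* b) ≈-refl (U (suc d)) (V (suc d)) (B d) n ⟩
      (U (suc d) ⊗ B d) n ℤ.- (V (suc d) ⊗ B d) n
        ≡⟨ cong₂ ℤ._-_ (U-rec d n) (V-rec d n) ⟩
      (P d ⊕ zS ⊗ around U d) n ℤ.- (P d ⊕ zS ⊗ around V d) n
        ≡⟨ ZP.i≡j⇒i-j≡0 (cong (λ x → P d n ℤ.+ x) (zS⊗around-agree n below d)) ⟩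
      0ℤ ∎

-- Counting bounded trees

-- Tdepth d is the paper's T_{d-1}; the fuel f only has to exceed the coefficient index.
Tdepth-fuel : ℕ → ℕ → PS
Tdepth-fuel zero    d             = 𝟙
Tdepth-fuel (suc f) zero          = 𝟙
Tdepth-fuel (suc f) (suc d) zero    = 1ℤ
Tdepth-fuel (suc f) (suc d) (suc n) = around (Tdepth-fuel f) d n

Tdepth : ℕ → PS
Tdepth d n = Tdepth-fuel n d n

Tdepth-fuel-suc : ∀ f d n → n N.≤ f → Tdepth-fuel f d n ≡ Tdepth-fuel (suc f) d n
Tdepth-fuel-suc zero    zero    zero    _         = refl
Tdepth-fuel-suc zero    (suc d) zero    _         = refl
Tdepth-fuel-suc (suc f) zero    n       _         = refl
Tdepth-fuel-suc (suc f) (suc d) zero    _         = refl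
Tdepth-fuel-suc (suc f) (suc d) (suc n) (s≤s n≤f) =
  ⊗-agreeUpTo (⊗-agreeUpTo (stable (2 N.+ d)) (stable (1 N.+ d))) (stable d) n NP.≤-refl
  where
  stable : ∀ e → AgreeUpTo n (Tdepth-fuel f e) (Tdepth-fuel (suc f) e)
  stable e i i≤n = Tdepth-fuel-suc f e i (NP.≤-trans i≤n n≤f)

Tdepth-fuel-stable : ∀ f d n → n N.≤ f → Tdepth d n ≡ Tdepth-fuel f d n
Tdepth-fuel-stable zero    d zero _   = refl
Tdepth-fuel-stable (suc f) d n   n≤1+f with NP.m≤n⇒m<n∨m≡n n≤1+f
... | inj₁ (s≤s n≤f) = trans (Tdepth-fuel-stable f d n n≤f) (Tdepth-fuel-suc f d n n≤f)
... | inj₂ refl      = refl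

Tdepth-suc-coeff : ∀ d n → Tdepth (suc d) (suc n) ≡ around Tdepth d n
Tdepth-suc-coeff d n =
  ⊗-agreeUpTo (⊗-agreeUpTo (unfuel (2 N.+ d)) (unfuel (1 N.+ d))) (unfuel d) n NP.≤-refl
  where
  unfuel : ∀ e → AgreeUpTo n (Tdepth-fuel n e) (Tdepth e)
  unfuel e i i≤n = sym (Tdepth-fuel-stable n e i i≤n)

Tdepth-zero : Tdepth 0 ≈ 𝟙
Tdepth-zero zero    = refl
Tdepth-zero (suc n) = refl

Tdepth-suc : ∀ d → Tdepth (suc d) ≈ 𝟙 ⊕ zS ⊗ around Tdepth d
Tdepth-suc d zero    = refl
Tdepth-suc d (suc n) = trans (Tdepth-suc-coeff d n)
  (sym (trans (ZP.+-identityˡ _) (zS⊗-suc (around Tdepth d) n)))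

HasCount : Set → ℤ → Set
HasCount A z = Σ ℕ (λ c → (z ≡ + c) × (Fin c ↔ A))

count-unique : ∀ {A z w} → HasCount A z → HasCount A w → z ≡ w
count-unique (c , z≡c , Fc↔A) (c′ , w≡c′ , Fc′↔A) =
  trans z≡c (trans (cong +_ (Perm.↔⇒≡ (↔-trans Fc↔A (↔-sym Fc′↔A)))) (sym w≡c′))

count-≡ : ∀ {A z w} → z ≡ w → HasCount A z → HasCount A w
count-≡ z≡w (c , z≡c , Fc↔A) = c , trans (sym z≡w) z≡c , Fc↔A

count-↔ : ∀ {A B z} → A ↔ B → HasCount A z → HasCount B z
count-↔ A↔B (c , z≡c , Fc↔A) = c , z≡c , ↔-trans Fc↔A A↔B

count-⊤ : HasCount ⊤ 1ℤ
count-⊤ = 1 , refl , FinP.1↔⊤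

count-⊥ : HasCount ⊥ 0ℤ
count-⊥ = 0 , refl , FinP.0↔⊥

count-⊎ : ∀ {A B x y} → HasCount A x → HasCount B y → HasCount (A ⊎ B) (x ℤ.+ y)
count-⊎ (a , x≡a , Fa↔A) (b , y≡b , Fb↔B) =
  a N.+ b , cong₂ ℤ._+_ x≡a y≡b , ↔-trans FinP.+↔⊎ (Fa↔A ⊎-↔ Fb↔B)

count-× : ∀ {A B x y} → HasCount A x → HasCount B y → HasCount (A × B) (x ℤ.* y)
count-× (a , x≡a , Fa↔A) (b , y≡b , Fb↔B) =
  a N.* b , trans (cong₂ ℤ._*_ x≡a y≡b) (sym (ZP.pos-* a b)) , ↔-trans FinP.*↔× (Fa↔A ×-↔ Fb↔B)

Σ≤ : ℕ → (ℕ → Set) → Set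
Σ≤ n A = Σ ℕ (λ i → i N.≤ n × A i)

Σ≤-zero↔ : ∀ (A : ℕ → Set) → A 0 ↔ Σ≤ 0 A
Σ≤-zero↔ A = mk↔ₛ′ (λ a → 0 , z≤n , a) (λ { (zero , z≤n , a) → a })
  (λ { (zero , z≤n , a) → refl }) (λ a → refl)

Σ≤-suc↔ : ∀ n (A : ℕ → Set) → (A 0 ⊎ Σ≤ n (A ∘ suc)) ↔ Σ≤ (suc n) A
Σ≤-suc↔ n A = mk↔ₛ′ to from
  (λ { (zero , z≤n , a) → refl ; (suc i , s≤s i≤n , a) → refl })
  (λ { (inj₁ a) → refl ; (inj₂ (i , i≤n , a)) → refl })
  where
  to : A 0 ⊎ Σ≤ n (A ∘ suc) → Σ≤ (suc n) A
  to (inj₁ a)             = 0 , z≤n , a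
  to (inj₂ (i , i≤n , a)) = suc i , s≤s i≤n , a
  from : Σ≤ (suc n) A → A 0 ⊎ Σ≤ n (A ∘ suc)
  from (zero  , z≤n     , a) = inj₁ a
  from (suc i , s≤s i≤n , a) = inj₂ (i , i≤n , a)

count-Σ≤ : ∀ n (h : ℕ → ℤ) (A : ℕ → Set) → (∀ i → i N.≤ n → HasCount (A i) (h i))
  → HasCount (Σ≤ n A) (sumTo n h)
count-Σ≤ zero    h A count = count-↔ (Σ≤-zero↔ A) (count 0 z≤n)
count-Σ≤ (suc n) h A count = count-≡ (sym (sumTo-suc n h)) (count-↔ (Σ≤-suc↔ n A)
  (count-⊎ (count 0 z≤n) (count-Σ≤ n (h ∘ suc) (A ∘ suc) (λ i i≤n → count (suc i) (s≤s i≤n)))))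

BoundedTreesAt : ℤ → ℤ → ℕ → Set
BoundedTreesAt j ℓ n = Σ Tern (λ t → (size t ≡ n) × Bounded j ℓ t)

leaf↔ : ∀ j ℓ → ⊤ ↔ BoundedTreesAt j ℓ 0
leaf↔ j ℓ = mk↔ₛ′ (λ _ → leaf , refl , tt) (λ _ → tt)
  (λ { (leaf , e , tt) → cong (λ e → leaf , e , tt) (NP.≡-irrelevant refl e)
     ; (node _ _ _ , () , _) })
  (λ _ → refl)

no-node↔ : ∀ j ℓ n → ¬ ℓ ≤ j → ⊥ ↔ BoundedTreesAt j ℓ (suc n)
no-node↔ j ℓ n ℓ≰j = mk↔ₛ′ (λ ()) no-node (λ t → ⊥-elim (no-node t)) (λ ())
  where
  no-node : BoundedTreesAt j ℓ (suc n) → ⊥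
  no-node (leaf , () , _)
  no-node (node _ _ _ , _ , ℓ≤j , _) = ℓ≰j ℓ≤j

Subtrees : ℤ → ℤ → ℕ → Set
Subtrees j ℓ n = Σ≤ n (λ i →
  Σ≤ i (λ a → BoundedTreesAt j (ℓ ℤ.- 1ℤ) a × BoundedTreesAt j ℓ (i ∸ a))
  × BoundedTreesAt j (ℓ ℤ.+ 1ℤ) (n ∸ i))

module _ (j ℓ : ℤ) (n : ℕ) (ℓ≤j : ℓ ≤ j) where

  private
    join : Subtrees j ℓ n → BoundedTreesAt j ℓ (suc n)
    join (i , i≤n , (a , a≤i , (l , refl , bl) , (c , c≡ , bc)) , (r , r≡ , br)) =
      node l c r , cong suc sizes , ℓ≤j , bl , bc , br
      where
      open ≡-Reasoning
      sizes : size l N.+ size c N.+ size r ≡ n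
      sizes = begin
        size l N.+ size c N.+ size r ≡⟨ cong₂ (λ x y → size l N.+ x N.+ y) c≡ r≡ ⟩
        size l N.+ (i ∸ size l) N.+ (n ∸ i) ≡⟨ cong (N._+ (n ∸ i)) (NP.m+[n∸m]≡n a≤i) ⟩
        i N.+ (n ∸ i)                      ≡⟨ NP.m+[n∸m]≡n i≤n ⟩
        n ∎

    split : BoundedTreesAt j ℓ (suc n) → Subtrees j ℓ n
    split (leaf , () , _)
    split (node l c r , sizes , _ , bl , bc , br) =
      size l N.+ size c , lc≤n ,
        (size l , NP.m≤m+n (size l) (size c) , (l , refl , bl) ,
          (c , sym (NP.m+n∸m≡n (size l) (size c)) , bc)) ,
        (r , trans (sym (NP.m+n∸m≡n (size l N.+ size c) (size r))) (cong (_∸ (size l N.+ size c)) sizes′) , br)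
      where
      sizes′ : size l N.+ size c N.+ size r ≡ n
      sizes′ = NP.suc-injective sizes
      lc≤n : size l N.+ size c N.≤ n
      lc≤n = subst (size l N.+ size c N.≤_) sizes′ (NP.m≤m+n _ (size r))

    join-split : ∀ t → join (split t) ≡ t
    join-split (leaf , () , _)
    join-split (node l c r , sizes , ℓ≤j′ , bl , bc , br) =
      cong₂ (λ e p → node l c r , e , p , bl , bc , br) (NP.≡-irrelevant _ _) (ZP.≤-irrelevant _ _)

    same-trees : ∀ {a} (l : BoundedTreesAt j (ℓ ℤ.- 1ℤ) a) {c} (bc : Bounded j ℓ c)
      {r} (br : Bounded j (ℓ ℤ.+ 1ℤ) r) {i i′} → i ≡ i′ →
      (i≤n : i N.≤ n) (i′≤n : i′ N.≤ n) (a≤i : a N.≤ i) (a≤i′ : a N.≤ i′)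
      (c≡ : size c ≡ i ∸ a) (c≡′ : size c ≡ i′ ∸ a) (r≡ : size r ≡ n ∸ i) (r≡′ : size r ≡ n ∸ i′) →
      _≡_ {A = Subtrees j ℓ n}
        (i  , i≤n  , (a , a≤i  , l , (c , c≡  , bc)) , (r , r≡  , br))
        (i′ , i′≤n , (a , a≤i′ , l , (c , c≡′ , bc)) , (r , r≡′ , br))
    same-trees l bc br refl i≤n i′≤n a≤i a≤i′ c≡ c≡′ r≡ r≡′
      rewrite NP.≤-irrelevant i≤n i′≤n | NP.≤-irrelevant a≤i a≤i′
            | NP.≡-irrelevant c≡ c≡′ | NP.≡-irrelevant r≡ r≡′ = refl

    split-join : ∀ s → split (join s) ≡ s
    split-join (i , i≤n , (a , a≤i , (l , refl , bl) , (c , c≡ , bc)) , (r , r≡ , br)) =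
      same-trees (l , refl , bl) bc br (trans (cong (size l N.+_) c≡) (NP.m+[n∸m]≡n a≤i))
        _ i≤n _ a≤i _ c≡ _ r≡

  node↔ : Subtrees j ℓ n ↔ BoundedTreesAt j ℓ (suc n)
  node↔ = mk↔ₛ′ join split join-split split-join

-- ℓ ℤ.+ + d ≡ j ℤ.+ 1ℤ says that a node with label ℓ lies d levels below the forbidden label j + 1.
module _ {j ℓ : ℤ} {d : ℕ} where

  distance-left : ℓ ℤ.+ + suc d ≡ j ℤ.+ 1ℤ → (ℓ ℤ.- 1ℤ) ℤ.+ + suc (suc d) ≡ j ℤ.+ 1ℤ
  distance-left = trans (ℤ-solve 2 (λ l x →
    (l ℤ:- ℤ-con 1ℤ) ℤ:+ (ℤ-con 1ℤ ℤ:+ (ℤ-con 1ℤ ℤ:+ x)) ℤ:= l ℤ:+ (ℤ-con 1ℤ ℤ:+ x)) refl ℓ (+ d))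

  distance-right : ℓ ℤ.+ + suc d ≡ j ℤ.+ 1ℤ → (ℓ ℤ.+ 1ℤ) ℤ.+ + d ≡ j ℤ.+ 1ℤ
  distance-right = trans (ℤ-solve 2 (λ l x →
    (l ℤ:+ ℤ-con 1ℤ) ℤ:+ x ℤ:= l ℤ:+ (ℤ-con 1ℤ ℤ:+ x)) refl ℓ (+ d))

  distance-suc⇒≤ : ℓ ℤ.+ + suc d ≡ j ℤ.+ 1ℤ → ℓ ≤ j
  distance-suc⇒≤ dist = subst (ℓ ≤_) ℓ+d≡j (ZP.i≤i+j ℓ (+ d))
    where
    ℓ+d≡j : ℓ ℤ.+ + d ≡ j
    ℓ+d≡j = trans (ℤ-solve 2 (λ l x → l ℤ:+ x ℤ:= (l ℤ:+ (ℤ-con 1ℤ ℤ:+ x)) ℤ:- ℤ-con 1ℤ) refl ℓ (+ d))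
      (trans (cong (ℤ._- 1ℤ) dist) (ℤ-solve 1 (λ k → (k ℤ:+ ℤ-con 1ℤ) ℤ:- ℤ-con 1ℤ ℤ:= k) refl j))

distance-zero⇒≰ : ∀ {j ℓ} → ℓ ℤ.+ + 0 ≡ j ℤ.+ 1ℤ → ¬ ℓ ≤ j
distance-zero⇒≰ {j} {ℓ} dist ℓ≤j = ZP.<-irrefl refl (ZP.suc[i]≤j⇒i<j (subst (_≤ j) ℓ≡1+j ℓ≤j))
  where
  ℓ≡1+j : ℓ ≡ 1ℤ ℤ.+ j
  ℓ≡1+j = trans (sym (ZP.+-identityʳ ℓ)) (trans dist (ZP.+-comm j 1ℤ))

count-bounded : ∀ j n d ℓ → ℓ ℤ.+ + d ≡ j ℤ.+ 1ℤ → HasCount (BoundedTreesAt j ℓ n) (Tdepth d n)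
count-bounded j = <-rec (λ n → ∀ d ℓ → ℓ ℤ.+ + d ≡ j ℤ.+ 1ℤ → HasCount (BoundedTreesAt j ℓ n) (Tdepth d n)) λ
  { zero    _     d       ℓ _    → count-↔ (leaf↔ j ℓ) count-⊤
  ; (suc n) _     zero    ℓ dist → count-↔ (no-node↔ j ℓ n (distance-zero⇒≰ dist)) count-⊥
  ; (suc n) below (suc d) ℓ dist →
      count-≡ (sym (Tdepth-suc-coeff d n)) (count-↔ (node↔ j ℓ n (distance-suc⇒≤ dist))
        (count-Σ≤ n _ _ λ i i≤n → count-×
          (count-Σ≤ i _ _ λ a a≤i → count-×
            (below (s≤s (NP.≤-trans a≤i i≤n)) (2 N.+ d) (ℓ ℤ.- 1ℤ) (distance-left {j} {ℓ} {d} dist))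
            (below (s≤s (NP.≤-trans (NP.m∸n≤m i a) i≤n)) (suc d) ℓ dist))
          (below (s≤s (NP.m∸n≤m n i)) d (ℓ ℤ.+ 1ℤ) (distance-right {j} {ℓ} {d} dist)))) }

isTjGF⇒≈Tdepth : ∀ j d F → j ℤ.+ 1ℤ ≡ + d → IsTjGF j F → F ≈ Tdepth d
isTjGF⇒≈Tdepth j d F j+1≡d isGF n =
  count-unique (isGF n) (count-bounded j n d 0ℤ (trans (ZP.+-identityˡ (+ d)) (sym j+1≡d)))

-- The series T and X

pow* : ∀ {m} → Polynomial m → ℕ → Polynomial m → Polynomial m
pow* x zero    y = y
pow* x (suc k) y = x P* pow* x k y

module TernarySeries (T X : PS) (T₀≡1 : T 0 ≡ 1ℤ) (T-eq : T ≈ 𝟙 ⊕ zS ⊗ T ^ 3)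
                     (X₀≡0 : X 0 ≡ 0ℤ) (X-eq : X ≈ zS ⊗ T ^ 2 ⊗ (𝟙 ⊕ X ⊕ X ^ 2)) where

  Y Q : PS
  Y = 𝟙 ⊕ X ⊕ X ^ 2
  Q = 𝟙 ⊕ X ^ 2

  pY pQ : ∀ {m} → Polynomial m → Polynomial m
  pY x = con 1ℤ P+ x P+ x P^ 2
  pQ x = con 1ℤ P+ x P^ 2

  T-eq⊖ : T ⊖ (𝟙 ⊕ zS ⊗ T ^ 3) ≈ 𝟘
  T-eq⊖ = ≈⇒⊖≈𝟘 T-eq

  X-eq⊖ : X ⊖ zS ⊗ T ^ 2 ⊗ Y ≈ 𝟘
  X-eq⊖ = ≈⇒⊖≈𝟘 X-eq

  T-closed-form : T ⊗ Q ≈ Y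
  T-closed-form = ≈-cancelʳ (𝟙 ⊖ zS ⊗ T ^ 2) (λ ()) (≈-trans
    (solve 3 (λ T x z →
        (T P* pQ x P- pY x) P* (con 1ℤ P- z P* T P^ 2)
        P= pQ x P* (T P- (con 1ℤ P+ z P* T P^ 3)) P+ con (ℤ.- 1ℤ) P* (x P- z P* T P^ 2 P* pY x))
      ≈-refl T X zS)
    (lincomb₂-≈𝟘 Q (cst (ℤ.- 1ℤ)) T-eq⊖ X-eq⊖))

  T-closed-form⊖ : T ⊗ Q ⊖ Y ≈ 𝟘
  T-closed-form⊖ = ≈⇒⊖≈𝟘 T-closed-form

  X-functional-equation : X ⊗ Q ^ 2 ≈ zS ⊗ Y ^ 3
  X-functional-equation = ⊖≈𝟘⇒≈ (≈-trans
    (solve 3 (λ T x z →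
        x P* pQ x P^ 2 P- z P* pY x P^ 3
        P= pQ x P^ 2 P* (x P- z P* T P^ 2 P* pY x)
           P+ (z P* pY x P* (T P* pQ x P+ pY x)) P* (T P* pQ x P- pY x))
      ≈-refl T X zS)
    (lincomb₂-≈𝟘 (Q ^ 2) (zS ⊗ Y ⊗ (T ⊗ Q ⊕ Y)) X-eq⊖ T-closed-form⊖))

  T-nonNeg : ∀ n → 0ℤ ≤ T n
  T-nonNeg = nonNeg-induction T (subst (0ℤ ≤_) (sym T₀≡1) 0≤+) λ m T≥0 →
    subst (0ℤ ≤_) (sym (T-suc m)) (nonNeg-^ 3 T≥0 m NP.≤-refl)
    where
    T-suc : ∀ m → T (suc m) ≡ (T ^ 3) m
    T-suc m = trans (T-eq (suc m)) (trans (ZP.+-identityˡ _) (zS⊗-suc (T ^ 3) m))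

  X-nonNeg : ∀ n → 0ℤ ≤ X n
  X-nonNeg = nonNeg-induction X (subst (0ℤ ≤_) (sym X₀≡0) 0≤+) λ m X≥0 →
    subst (0ℤ ≤_) (sym (X-suc m))
      (nonNeg-⊗ (nonNeg-^ 2 (λ i _ → T-nonNeg i)) (nonNeg-⊕ (nonNeg-⊕ (nonNeg-𝟙 m) X≥0) (nonNeg-^ 2 X≥0))
        m NP.≤-refl)
    where
    X-suc : ∀ m → X (suc m) ≡ (T ^ 2 ⊗ Y) m
    X-suc m = trans (X-eq (suc m)) (trans (⊗-assoc zS (T ^ 2) Y (suc m)) (zS⊗-suc (T ^ 2 ⊗ Y) m))

  -- The complementary factor, with constant term -2, belongs to the other root of the quadratic.
  X-root-in-zT² : ∀ S → S 0 ≡ 1ℤ → S ⊗ S ≈ 𝟙 ⊖ (+ 2) · zS ⊗ T ^ 2 ⊖ (+ 3) · (zS ^ 2 ⊗ T ^ 4)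
    → (+ 2) · zS ⊗ T ^ 2 ⊗ X ≈ 𝟙 ⊖ zS ⊗ T ^ 2 ⊖ S
  X-root-in-zT² S S₀≡1 S² = ≈-trans (⊗-cong (⊗-cong (·≈cst⊗ (+ 2) zS) (≈-refl {T ^ 2})) (≈-refl {X}))
    (≈-cancelʳ other-factor other-factor₀≢0 (≈-trans
      (solve 4 (λ T x z S →
          (con (+ 2) P* z P* T P^ 2 P* x P- (con 1ℤ P- z P* T P^ 2 P- S))
            P* (con (+ 2) P* z P* T P^ 2 P* x P- con 1ℤ P+ z P* T P^ 2 P- S)
          P= con (ℤ.- (+ 4)) P* z P* T P^ 2 P* (x P- z P* T P^ 2 P* pY x)
             P+ con (ℤ.- 1ℤ) P* (S P* S P- (con 1ℤ P- con (+ 2) P* z P* T P^ 2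
                                               P- con (+ 3) P* (z P^ 2 P* T P^ 4))))
        ≈-refl T X zS S)
      (lincomb₂-≈𝟘 (cst (ℤ.- (+ 4)) ⊗ zS ⊗ T ^ 2) (cst (ℤ.- 1ℤ)) X-eq⊖ S²⊖)))
    where
    S²⊖ : S ⊗ S ⊖ (𝟙 ⊖ cst (+ 2) ⊗ zS ⊗ T ^ 2 ⊖ cst (+ 3) ⊗ (zS ^ 2 ⊗ T ^ 4)) ≈ 𝟘
    S²⊖ = ≈⇒⊖≈𝟘 (≈-trans S² (⊕-cong
      (⊕-cong (≈-refl {𝟙}) (neg-cong (⊗-cong (·≈cst⊗ (+ 2) zS) (≈-refl {T ^ 2}))))
      (neg-cong (·≈cst⊗ (+ 3) (zS ^ 2 ⊗ T ^ 4)))))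
    other-factor : PS
    other-factor = cst (+ 2) ⊗ zS ⊗ T ^ 2 ⊗ X ⊖ 𝟙 ⊕ zS ⊗ T ^ 2 ⊖ S
    other-factor₀≢0 : other-factor 0 ≢ 0ℤ
    other-factor₀≢0 = subst (_≢ 0ℤ) (cong (λ s → -[1+ 0 ] ℤ.- s) (sym S₀≡1)) (λ ())

  X-root-in-T-1 : ∀ R → R 0 ≡ 1ℤ → R ⊗ R ≈ 𝟙 ⊖ (+ 4) · (T ⊖ 𝟙) ^ 2
    → (+ 2) · (T ⊖ 𝟙) ⊗ X ≈ 𝟙 ⊖ R
  X-root-in-T-1 R R₀≡1 R² = ≈-trans (⊗-cong (·≈cst⊗ (+ 2) (T ⊖ 𝟙)) (≈-refl {X}))
    (≈-cancelʳ other-factor other-factor₀≢0 (≈-trans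
      (solve 3 (λ T x R →
          (con (+ 2) P* (T P- con 1ℤ) P* x P- (con 1ℤ P- R))
            P* (con (+ 2) P* (T P- con 1ℤ) P* x P- con 1ℤ P- R)
          P= con (+ 4) P* (T P- con 1ℤ) P* (T P* pQ x P- pY x)
             P+ con (ℤ.- 1ℤ) P* (R P* R P- (con 1ℤ P- con (+ 4) P* (T P- con 1ℤ) P^ 2)))
        ≈-refl T X R)
      (lincomb₂-≈𝟘 (cst (+ 4) ⊗ (T ⊖ 𝟙)) (cst (ℤ.- 1ℤ)) T-closed-form⊖ R²⊖)))
    where
    R²⊖ : R ⊗ R ⊖ (𝟙 ⊖ cst (+ 4) ⊗ (T ⊖ 𝟙) ^ 2) ≈ 𝟘
    R²⊖ = ≈⇒⊖≈𝟘 (≈-trans R² (⊕-cong (≈-refl {𝟙}) (neg-cong (·≈cst⊗ (+ 4) ((T ⊖ 𝟙) ^ 2)))))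
    other-factor : PS
    other-factor = cst (+ 2) ⊗ (T ⊖ 𝟙) ⊗ X ⊖ 𝟙 ⊖ R
    other-factor₀≢0 : other-factor 0 ≢ 0ℤ
    other-factor₀≢0 = subst (_≢ 0ℤ) (sym other-factor₀) (λ ())
      where
      a : ℤ
      a = (cst (+ 2) ⊗ (T ⊖ 𝟙)) 0
      other-factor₀ : other-factor 0 ≡ ℤ.- (+ 2)
      other-factor₀ = trans (cong₂ (λ x r → a ℤ.* x ℤ.+ -[1+ 0 ] ℤ.- r) X₀≡0 R₀≡1)
                            (cong (λ y → y ℤ.+ -[1+ 0 ] ℤ.- 1ℤ) (ZP.*-zeroʳ a))

  1-X^ : ℕ → PS
  1-X^ k = 𝟙 ⊖ X ^ k

  1-X^-coeff₀ : ∀ k → 1-X^ (suc k) 0 ≡ 1ℤ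
  1-X^-coeff₀ k = cong (λ x → 1ℤ ℤ.- x ℤ.* (X ^ k) 0) X₀≡0

  Q₀≢0 : Q 0 ≢ 0ℤ
  Q₀≢0 = subst (_≢ 0ℤ) (sym (cong (λ x → 1ℤ ℤ.+ x ℤ.* (x ℤ.* 1ℤ)) X₀≡0)) (λ ())

  -- The paper's T_j (1 - X^{j+3}) (1 - X^{j+4}) and T (1 - X^{j+2}) (1 - X^{j+5}) with d = j + 1.
  numerator : (ℕ → PS) → ℕ → PS
  numerator G d = G d ⊗ 1-X^ (2 N.+ d) ⊗ 1-X^ (3 N.+ d)

  candidate : ℕ → PS
  candidate d = T ⊗ 1-X^ (1 N.+ d) ⊗ 1-X^ (4 N.+ d)

  denominator : ℕ → PS
  denominator d = 1-X^ (2 N.+ d) ⊗ 1-X^ (3 N.+ d)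

  1-xᵏ : ∀ {m} → Polynomial m → ℕ → Polynomial m → Polynomial m
  1-xᵏ x k y = con 1ℤ P- pow* x k y

  -- Multiplying the recursion of candidate by Q and substituting T Q = Y and z T³ Q = X
  -- leaves (1 - X^{d+2}) ⋯ (1 - X^{d+5}) times this identity.
  product-identity : ∀ d →
    Y ⊗ 1-X^ (2 N.+ d) ⊗ 1-X^ (5 N.+ d) ⊖ Q ⊗ 1-X^ (3 N.+ d) ⊗ 1-X^ (4 N.+ d)
      ⊖ X ⊗ 1-X^ (1 N.+ d) ⊗ 1-X^ (6 N.+ d) ≈ 𝟘
  product-identity d = solve 2 (λ x y →
      pY x P* 1-xᵏ x 2 y P* 1-xᵏ x 5 y P- pQ x P* 1-xᵏ x 3 y P* 1-xᵏ x 4 y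
      P- x P* 1-xᵏ x 1 y P* 1-xᵏ x 6 y P= con 0ℤ)
    ≈-refl X (X ^ d)

  candidate-recursion : ∀ d →
    candidate (suc d) ⊗ (denominator d ⊗ denominator (2 N.+ d))
      ≈ denominator d ⊗ denominator (1 N.+ d) ⊗ denominator (2 N.+ d) ⊕ zS ⊗ around candidate d
  candidate-recursion d = ≈-cancelʳ Q Q₀≢0 (≈-trans
    (solve 9 (λ T z x f₁ f₂ f₃ f₄ f₅ f₆ →
      (T P* f₂ P* f₅ P* ((f₂ P* f₃) P* (f₄ P* f₅))
         P- ((f₂ P* f₃) P* (f₃ P* f₄) P* (f₄ P* f₅)
             P+ z P* (T P* f₃ P* f₆ P* (T P* f₂ P* f₅) P* (T P* f₁ P* f₄)))) P* pQ x
      P= (f₂ P* f₅ P* ((f₂ P* f₃) P* (f₄ P* f₅)) P- f₃ P* f₆ P* (f₂ P* f₅) P* (f₁ P* f₄))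
           P* (T P* pQ x P- pY x)
         P+ pQ x P* (f₃ P* f₆ P* (f₂ P* f₅) P* (f₁ P* f₄)) P* (T P- (con 1ℤ P+ z P* T P^ 3))
         P+ f₂ P* f₃ P* f₄ P* f₅ P* (pY x P* f₂ P* f₅ P- pQ x P* f₃ P* f₄ P- x P* f₁ P* f₆))
      ≈-refl T zS X (f 1) (f 2) (f 3) (f 4) (f 5) (f 6))
    (lincomb₃-≈𝟘 (f 2 ⊗ f 5 ⊗ (f 2 ⊗ f 3 ⊗ (f 4 ⊗ f 5)) ⊖ N³) (Q ⊗ N³) (f 2 ⊗ f 3 ⊗ f 4 ⊗ f 5)
                 T-closed-form⊖ T-eq⊖ (product-identity d)))
    where
    f : ℕ → PS
    f k = 1-X^ (k N.+ d)
    N³ : PS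
    N³ = f 3 ⊗ f 6 ⊗ (f 2 ⊗ f 5) ⊗ (f 1 ⊗ f 4)

  numerator-recursion : ∀ G → (∀ d → G (suc d) ≈ 𝟙 ⊕ zS ⊗ around G d) → ∀ d →
    numerator G (suc d) ⊗ (denominator d ⊗ denominator (2 N.+ d))
      ≈ denominator d ⊗ denominator (1 N.+ d) ⊗ denominator (2 N.+ d) ⊕ zS ⊗ around (numerator G) d
  numerator-recursion G G-suc d =
    ≈-trans (⊗-cong (⊗-cong (⊗-cong (G-suc d) (≈-refl {f 3})) (≈-refl {f 4})) (≈-refl {f 2 ⊗ f 3 ⊗ (f 4 ⊗ f 5)}))
      (solve 8 (λ g₂ g₁ g₀ z f₂ f₃ f₄ f₅ →
          (con 1ℤ P+ z P* (g₂ P* g₁ P* g₀)) P* f₃ P* f₄ P* ((f₂ P* f₃) P* (f₄ P* f₅))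
          P= (f₂ P* f₃) P* (f₃ P* f₄) P* (f₄ P* f₅)
             P+ z P* (g₂ P* f₄ P* f₅ P* (g₁ P* f₃ P* f₄) P* (g₀ P* f₂ P* f₃)))
        ≈-refl (G (2 N.+ d)) (G (1 N.+ d)) (G d) zS (f 2) (f 3) (f 4) (f 5))
    where
    f : ℕ → PS
    f k = 1-X^ (k N.+ d)

  numerator-base : ∀ G → G 0 ≈ 𝟙 → numerator G 0 ≈ candidate 0
  numerator-base G G-zero = ≈-cancelʳ Q Q₀≢0 (≈-trans
    (solve 3 (λ T x g →
        (g P* (con 1ℤ P- x P^ 2) P* (con 1ℤ P- x P^ 3) P- T P* (con 1ℤ P- x P^ 1) P* (con 1ℤ P- x P^ 4))
          P* pQ x
        P= pQ x P* ((con 1ℤ P- x P^ 2) P* (con 1ℤ P- x P^ 3)) P* (g P- con 1ℤ)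
           P+ con (ℤ.- 1ℤ) P* ((con 1ℤ P- x P^ 1) P* (con 1ℤ P- x P^ 4)) P* (T P* pQ x P- pY x))
      ≈-refl T X (G 0))
    (lincomb₂-≈𝟘 (Q ⊗ denominator 0) (cst (ℤ.- 1ℤ) ⊗ (1-X^ 1 ⊗ 1-X^ 4)) (≈⇒⊖≈𝟘 G-zero) T-closed-form⊖))

  numerator≈candidate : ∀ G → G 0 ≈ 𝟙 → (∀ d → G (suc d) ≈ 𝟙 ⊕ zS ⊗ around G d)
    → ∀ d → numerator G d ≈ candidate d
  numerator≈candidate G G-zero G-suc = recursion-unique (numerator G) candidate
    (λ d → denominator d ⊗ denominator (2 N.+ d))
    (λ d → denominator d ⊗ denominator (1 N.+ d) ⊗ denominator (2 N.+ d))
    (λ d → subst (_≢ 0ℤ) (sym (cong₂ ℤ._*_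
      (cong₂ ℤ._*_ (1-X^-coeff₀ (1 N.+ d)) (1-X^-coeff₀ (2 N.+ d)))
      (cong₂ ℤ._*_ (1-X^-coeff₀ (3 N.+ d)) (1-X^-coeff₀ (4 N.+ d))))) (λ ()))
    (numerator-base G G-zero) (numerator-recursion G G-suc) candidate-recursion

  boundedGF-identity : ∀ (j : ℤ) → -[1+ 0 ] ≤ j → ∀ (Tj : PS) → IsTjGF j Tj
    → Tj ⊗ (𝟙 ⊖ X ^ ∣ j ℤ.+ + 3 ∣) ⊗ (𝟙 ⊖ X ^ ∣ j ℤ.+ + 4 ∣)
      ≈ T ⊗ (𝟙 ⊖ X ^ ∣ j ℤ.+ + 2 ∣) ⊗ (𝟙 ⊖ X ^ ∣ j ℤ.+ + 5 ∣)
  boundedGF-identity j j≥-1 Tj isGF =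
    ≈-trans (⊗-cong (⊗-cong (isTjGF⇒≈Tdepth j d Tj j+1≡d isGF) (exponent 2)) (exponent 3))
      (≈-trans (numerator≈candidate Tdepth Tdepth-zero Tdepth-suc d)
               (≈-sym (⊗-cong (⊗-cong (≈-refl {T}) (exponent 1)) (exponent 4))))
    where
    d : ℕ
    d = ∣ j ℤ.+ 1ℤ ∣
    j+1≡d : j ℤ.+ 1ℤ ≡ + d
    j+1≡d = sym (ZP.0≤i⇒+∣i∣≡i (ZP.+-monoˡ-≤ 1ℤ j≥-1))
    exponent : ∀ k → 1-X^ ∣ j ℤ.+ + suc k ∣ ≈ 1-X^ (k N.+ d)
    exponent k n = cong (λ e → 1-X^ e n) (begin
      ∣ j ℤ.+ + suc k ∣         ≡⟨ cong ∣_∣ (ℤ-solve 2 (λ i x →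
                                     i ℤ:+ (ℤ-con 1ℤ ℤ:+ x) ℤ:= (i ℤ:+ ℤ-con 1ℤ) ℤ:+ x) refl j (+ k)) ⟩
      ∣ (j ℤ.+ 1ℤ) ℤ.+ + k ∣    ≡⟨ cong (λ i → ∣ i ℤ.+ + k ∣) j+1≡d ⟩
      d N.+ k                   ≡⟨ NP.+-comm d k ⟩
      k N.+ d                   ∎)
      where open ≡-Reasoning

theorem1 : (T X : PS) → T 0 ≡ 1ℤ → T ≈ 𝟙 ⊕ zS ⊗ T ^ 3
    → X 0 ≡ 0ℤ → X ≈ zS ⊗ T ^ 2 ⊗ (𝟙 ⊕ X ⊕ X ^ 2)
    → (X ⊗ (𝟙 ⊕ X ^ 2) ^ 2 ≈ zS ⊗ (𝟙 ⊕ X ⊕ X ^ 2) ^ 3)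
      × (T ⊗ (𝟙 ⊕ X ^ 2) ≈ 𝟙 ⊕ X ⊕ X ^ 2)
      × (∀ n → 0ℤ ≤ X n)
      × (∀ (S : PS) → S 0 ≡ 1ℤ
          → S ⊗ S ≈ 𝟙 ⊖ (+ 2) · zS ⊗ T ^ 2 ⊖ (+ 3) · (zS ^ 2 ⊗ T ^ 4)
          → (+ 2) · zS ⊗ T ^ 2 ⊗ X ≈ 𝟙 ⊖ zS ⊗ T ^ 2 ⊖ S)
      × (∀ (R : PS) → R 0 ≡ 1ℤ
          → R ⊗ R ≈ 𝟙 ⊖ (+ 4) · (T ⊖ 𝟙) ^ 2
          → (+ 2) · (T ⊖ 𝟙) ⊗ X ≈ 𝟙 ⊖ R)
      × (∀ (j : ℤ) → -[1+ 0 ] ≤ j → ∀ (Tj : PS) → IsTjGF j Tj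
          → Tj ⊗ (𝟙 ⊖ X ^ ∣ j ℤ.+ + 3 ∣) ⊗ (𝟙 ⊖ X ^ ∣ j ℤ.+ + 4 ∣)
            ≈ T ⊗ (𝟙 ⊖ X ^ ∣ j ℤ.+ + 2 ∣) ⊗ (𝟙 ⊖ X ^ ∣ j ℤ.+ + 5 ∣))
theorem1 T X T₀≡1 T-eq X₀≡0 X-eq =
  X-functional-equation , T-closed-form , X-nonNeg , X-root-in-zT² , X-root-in-T-1 , boundedGF-identity
  where open TernarySeries T X T₀≡1 T-eq X₀≡0 X-eq
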